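{- For every integer $n\geq4$, every graph $H$ with $V(H)=V(\mathcal{C}_n)$, $E(H)\subseteq E(\mathcal{C}_n^2)$ and minimum degree $\delta(H)\geq3$ is Hamiltonian.
   Context: $\mathcal{C}_n$ denotes a cycle on $n$ vertices; $\mathcal{C}_n^2$ is its square, i.e. the graph on $V(\mathcal{C}_n)$ in which two distinct vertices are adjacent iff their distance in $\mathcal{C}_n$ is at most $2$. -}

module Defs where

open import Data.Nat using (ℕ; zero; suc; _+_; _∸_; _≤_; _<_; _⊓_)
open import Data.Nat.Properties using (≤-pred)
open import Data.Fin using (Fin; toℕ; fromℕ<)
open import Data.Fin.Properties using (toℕ<n)
open import Data.List using (List; length; filter)
open import Data.List using () renaming (allFin to allFinL)
open import Data.Product using (Σ; _×_)
open import Function.Definitions using (Injective)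
open import Relation.Binary.PropositionalEquality using (_≡_)
open import Relation.Nullary using (¬_; Dec)
open import Relation.Unary using (Decidable)

record Graph (n : ℕ) : Set₁ where
  field
    Adj    : Fin n → Fin n → Set
    adj?   : (i j : Fin n) → Dec (Adj i j)
    sym    : ∀ {i j} → Adj i j → Adj j i
    irrefl : ∀ {i} → ¬ Adj i i

open Graph public

degree : ∀ {n} → Graph n → Fin n → ℕ
degree {n} G i = length (filter (adj? G i) (allFinL n))

MinDegreeAtLeast : ∀ {n} → ℕ → Graph n → Set
MinDegreeAtLeast k G = ∀ i → k ≤ degree G i

∣_-_∣ : ℕ → ℕ → ℕ
∣ a - b ∣ = (a ∸ b) + (b ∸ a)

cycDist : ∀ {n} → Fin n → Fin n → ℕ
cycDist {n} i j = ∣ toℕ i - toℕ j ∣ ⊓ (n ∸ ∣ toℕ i - toℕ j ∣)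

SqAdj : ∀ {n} → Fin n → Fin n → Set
SqAdj i j = ¬ (i ≡ j) × cycDist i j ≤ 2

SubgraphOfCycleSquare : ∀ {n} → Graph n → Set
SubgraphOfCycleSquare G = ∀ i j → Adj G i j → SqAdj i j

sucMod : ∀ {n} → Fin n → Fin n
sucMod {suc n} i with suc (toℕ i) Data.Nat.≟ suc n
... | Relation.Nullary.yes _ = Data.Fin.zero
... | Relation.Nullary.no ¬p = fromℕ< {suc (toℕ i)} (lemma (toℕ<n i) ¬p)
  where
  open import Data.Nat.Properties using (≤∧≢⇒<)
  lemma : ∀ {a m} → a < suc m → ¬ (suc a ≡ suc m) → suc a < suc m
  lemma a<m ne = ≤∧≢⇒< a<m ne

-- Hamiltonian: a cyclic ordering v₀,…,v_{n-1} of all vertices (injective,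
-- hence bijective on Fin n) with v_k adjacent to v_{k+1 mod n} for all k.
Hamiltonian : ∀ {n} → Graph n → Set
Hamiltonian {n} G =
  Σ (Fin n → Fin n) λ v → Injective _≡_ _≡_ v × (∀ k → Adj G (v k) (v (sucMod k)))

-- Label the vertices by natural numbers modulo n. In the square of the cycle a vertex has
-- at most four neighbours (its two successors and its two predecessors), so minimum degree
-- 3 means that every vertex misses at most one of them. Call p a gap if the cycle edge
-- p(p+1) is missing. Then gaps are isolated and the chords around a gap are present.
-- If two consecutive cycle edges are present somewhere, start right after them and walk
-- along the cycle, replacing p, p+1, p+2, p+3 by the detour p, p+2, p+1, p+3 at every gap p
-- that is not bypassed yet; the two present edges close the tour. Otherwise gaps and cycle
-- edges alternate, which forces n to be even and all chords to be present; relabelled so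
-- that 01 is a cycle edge, the tour 1, 3, …, n−1, n−2, …, 2, 0 works.
module Submission where

open import Defs hiding (sym)
open import Data.Bool using (Bool; true; false; not; _∧_; if_then_else_)
open import Data.Bool.Properties using (∧-zeroʳ; ¬-not)
open import Data.Empty using (⊥)
open import Data.Fin using (Fin; toℕ)
open import Data.Fin.Properties using (toℕ-injective; toℕ-fromℕ<; toℕ<n)
open import Data.List using (List; []; _∷_; length; filter; allFin)
open import Data.List.Relation.Unary.All as All using (All; []; _∷_)
open import Data.List.Relation.Unary.All.Properties using (all-filter)
open import Data.List.Relation.Unary.Unique.Propositional using (Unique; []; _∷_)
open import Data.List.Relation.Unary.Unique.Propositional.Properties using (filter⁺; allFin⁺)
import Data.Nat
open import Data.Nat using (ℕ; zero; suc; pred; _+_; _*_; _∸_; _≤_; _<_; _⊓_; z≤n; s≤s; s≤s⁻¹; z<s; _<?_; _%_; NonZero)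
open import Data.Nat.DivMod using (_mod_; m%n<n; m%n%n≡m%n; n%n≡0; %-distribˡ-+; [m+n]%n≡m%n; [m+kn]%n≡m%n; m<n⇒m%n≡m)
open import Data.Nat.Properties
open import Data.Nat.Tactic.RingSolver using (solve-∀)
open import Data.Product using (∃-syntax; _×_; _,_; proj₁; proj₂)
open import Data.Sum as Sum using (_⊎_; inj₁; inj₂; swap; [_,_]′)
open import Function using (_∘_)
open import Relation.Binary.PropositionalEquality using (_≡_; _≢_; refl; sym; trans; cong; subst; subst₂; module ≡-Reasoning)
open import Relation.Nullary using (¬_; Dec; yes; no; does; contradiction; _×-dec_)
open import Relation.Nullary.Decidable using (decidable-stable)

module Residues {n : ℕ} .{{_ : NonZero n}} where

  toℕ-mod : ∀ a → toℕ (a mod n) ≡ a % n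
  toℕ-mod a = toℕ-fromℕ< (m%n<n a n)

  mod-cong : ∀ {a b} → a % n ≡ b % n → a mod n ≡ b mod n
  mod-cong {a} {b} eq = toℕ-injective (trans (toℕ-mod a) (trans eq (sym (toℕ-mod b))))

  toℕ-mod-id : ∀ (x : Fin n) → toℕ x mod n ≡ x
  toℕ-mod-id x = toℕ-injective (trans (toℕ-mod (toℕ x)) (m<n⇒m%n≡m (toℕ<n x)))

  [n+m]%n≡m%n : ∀ m → (n + m) % n ≡ m % n
  [n+m]%n≡m%n m = trans (cong (_% n) (+-comm n m)) ([m+n]%n≡m%n m n)

  [n∸k+[k+m]]%n≡m%n : ∀ {k} m → k ≤ n → (n ∸ k + (k + m)) % n ≡ m % n
  [n∸k+[k+m]]%n≡m%n {k} m k≤n =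
    trans (cong (_% n) (trans (sym (+-assoc (n ∸ k) k m)) (cong (_+ m) (m∸n+n≡m k≤n)))) ([n+m]%n≡m%n m)

  %-congˡ-+ : ∀ {a b} c → a % n ≡ b % n → (a + c) % n ≡ (b + c) % n
  %-congˡ-+ {a} {b} c eq = begin
    (a + c) % n             ≡⟨ %-distribˡ-+ a c n ⟩
    (a % n + c % n) % n     ≡⟨ cong (λ z → (z + c % n) % n) eq ⟩
    (b % n + c % n) % n     ≡⟨ %-distribˡ-+ b c n ⟨
    (b + c) % n             ∎
    where open ≡-Reasoning

  %-congʳ-+ : ∀ c {a b} → a % n ≡ b % n → (c + a) % n ≡ (c + b) % n
  %-congʳ-+ c {a} {b} eq = trans (cong (_% n) (+-comm c a)) (trans (%-congˡ-+ c eq) (cong (_% n) (+-comm b c)))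

  %-cancelʳ-+ : ∀ {a b} c → (a + c) % n ≡ (b + c) % n → a % n ≡ b % n
  %-cancelʳ-+ {a} {b} c eq = begin
    a % n                     ≡⟨ [m+kn]%n≡m%n a c n ⟨
    (a + c * n) % n           ≡⟨ cong (_% n) (split a) ⟩
    (a + c + c * pred n) % n  ≡⟨ %-congˡ-+ (c * pred n) eq ⟩
    (b + c + c * pred n) % n  ≡⟨ cong (_% n) (split b) ⟨
    (b + c * n) % n           ≡⟨ [m+kn]%n≡m%n b c n ⟩
    b % n                     ∎
    where
    open ≡-Reasoning
    split : ∀ x → x + c * n ≡ x + c + c * pred n
    split x = begin
      x + c * n              ≡⟨ cong (λ k → x + c * k) (suc-pred n) ⟨
      x + c * suc (pred n)   ≡⟨ cong (x +_) (*-suc c (pred n)) ⟩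
      x + (c + c * pred n)   ≡⟨ +-assoc x c _ ⟨
      x + c + c * pred n     ∎

toℕ-sucMod : ∀ {n} (i : Fin (suc n)) →
             (toℕ (sucMod i) ≡ suc (toℕ i) × suc (toℕ i) < suc n) ⊎ (toℕ (sucMod i) ≡ 0 × toℕ i ≡ n)
toℕ-sucMod {n} i with suc (toℕ i) Data.Nat.≟ suc n
... | yes 1+i≡1+n = inj₂ (refl , suc-injective 1+i≡1+n)
... | no  1+i≢1+n = inj₁ (toℕ-fromℕ< 1+i<1+n , 1+i<1+n)
  where 1+i<1+n = ≤∧≢⇒< (toℕ<n i) 1+i≢1+n

module _ {A : Set} where

  Unique-All≡⇒length≤1 : ∀ {q} {xs : List A} → Unique xs → All (_≡ q) xs → length xs ≤ 1
  Unique-All≡⇒length≤1 {xs = []}        _                  _                  = z≤n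
  Unique-All≡⇒length≤1 {xs = _ ∷ []}    _                  _                  = s≤s z≤n
  Unique-All≡⇒length≤1 {xs = _ ∷ _ ∷ _} ((x≢y ∷ _) ∷ _) (refl ∷ refl ∷ _) = contradiction refl x≢y

  Unique-All≡⊎≡⇒length≤2 : ∀ {p q} {xs : List A} → Unique xs → All (λ y → y ≡ p ⊎ y ≡ q) xs → length xs ≤ 2
  Unique-All≡⊎≡⇒length≤2 [] [] = z≤n
  Unique-All≡⊎≡⇒length≤2 (p∉xs ∷ u) (inj₁ refl ∷ ys) =
    s≤s (Unique-All≡⇒length≤1 u (All.zipWith (λ (p≢y , y∈) → other p≢y y∈) (p∉xs , ys)))
    where
    other : ∀ {x y q} → x ≢ y → y ≡ x ⊎ y ≡ q → y ≡ q
    other x≢y (inj₁ y≡x) = contradiction (sym y≡x) x≢y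
    other x≢y (inj₂ y≡q) = y≡q
  Unique-All≡⊎≡⇒length≤2 (q∉xs ∷ u) (inj₂ refl ∷ ys) =
    Unique-All≡⊎≡⇒length≤2 (q∉xs ∷ u) (inj₁ refl ∷ All.map swap ys)

degree≤2 : ∀ {n} (G : Graph n) {x p q} → (∀ y → Adj G x y → y ≡ p ⊎ y ≡ q) → degree G x ≤ 2
degree≤2 {n} G {x} nbrs =
  Unique-All≡⊎≡⇒length≤2 (filter⁺ (adj? G x) (allFin⁺ n)) (All.map (nbrs _) (all-filter (adj? G x) (allFin n)))

Offset : ℕ → ℕ → Set
Offset n k = k ≡ 1 ⊎ k ≡ 2 ⊎ k ≡ n ∸ 1 ⊎ k ≡ n ∸ 2

0<k≤2⇒k≡1⊎k≡2 : ∀ {k} → 0 < k → k ≤ 2 → k ≡ 1 ⊎ k ≡ 2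
0<k≤2⇒k≡1⊎k≡2 {1} _ _ = inj₁ refl
0<k≤2⇒k≡1⊎k≡2 {2} _ _ = inj₂ refl
0<k≤2⇒k≡1⊎k≡2 {suc (suc (suc _))} _ (s≤s (s≤s ()))

short⇒Offset : ∀ {n e} → 0 < e → e < n → e ⊓ (n ∸ e) ≤ 2 → Offset n e
short⇒Offset {n} {e} 0<e e<n short with ⊓-sel e (n ∸ e)
... | inj₁ min≡e   = [ inj₁ , inj₂ ∘ inj₁ ]′ (0<k≤2⇒k≡1⊎k≡2 0<e (subst (_≤ 2) min≡e short))
... | inj₂ min≡n∸e = inj₂ (inj₂ (Sum.map complement complement
                       (0<k≤2⇒k≡1⊎k≡2 (m<n⇒0<n∸m e<n) (subst (_≤ 2) min≡n∸e short))))
  where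
  complement : ∀ {k} → n ∸ e ≡ k → e ≡ n ∸ k
  complement n∸e≡k = trans (sym (m∸[m∸n]≡n (<⇒≤ e<n))) (cong (n ∸_) n∸e≡k)

short-complement : ∀ {n e} → e ≤ n → e ⊓ (n ∸ e) ≤ 2 → (n ∸ e) ⊓ (n ∸ (n ∸ e)) ≤ 2
short-complement {n} {e} e≤n short =
  subst (_≤ 2) (trans (⊓-comm e (n ∸ e)) (cong ((n ∸ e) ⊓_) (sym (m∸[m∸n]≡n e≤n)))) short

∣-∣≡∸ : ∀ {i j} → i ≤ j → ∣ i - j ∣ ≡ j ∸ i
∣-∣≡∸ {i} {j} i≤j = cong (_+ (j ∸ i)) (m≤n⇒m∸n≡0 i≤j)

module _ {n : ℕ} .{{_ : NonZero n}} where
  open Residues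

  SqAdj-offset : ∀ {i j} → i < n → j < n → i ≢ j → ∣ i - j ∣ ⊓ (n ∸ ∣ i - j ∣) ≤ 2 →
                 ∃[ k ] Offset n k × j % n ≡ (k + i) % n
  SqAdj-offset {i} {j} i<n j<n i≢j short with ≤-total i j
  ... | inj₁ i≤j =
    j ∸ i , short⇒Offset (m<n⇒0<n∸m (≤∧≢⇒< i≤j i≢j)) (≤-<-trans (m∸n≤m j i) j<n)
                         (subst (λ d → d ⊓ (n ∸ d) ≤ 2) (∣-∣≡∸ i≤j) short)
          , cong (_% n) (sym (m∸n+n≡m i≤j))
  ... | inj₂ j≤i =
    n ∸ e , short⇒Offset (m<n⇒0<n∸m e<n) (∸-monoʳ-< (m<n⇒0<n∸m (≤∧≢⇒< j≤i (i≢j ∘ sym))) (<⇒≤ e<n))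
                         (short-complement (<⇒≤ e<n) (subst (λ d → d ⊓ (n ∸ d) ≤ 2) e≡ short))
          , sym (trans (cong (λ x → (n ∸ e + x) % n) (sym (m∸n+n≡m j≤i))) ([n∸k+[k+m]]%n≡m%n j (<⇒≤ e<n)))
    where
    e = i ∸ j
    e<n = ≤-<-trans (m∸n≤m i j) i<n
    e≡ : ∣ i - j ∣ ≡ e
    e≡ = trans (+-comm (i ∸ j) (j ∸ i)) (∣-∣≡∸ j≤i)

  -- (n ∸ k + c) mod n is the k-th predecessor of c
  data Candidate (c : ℕ) : Fin n → Set where
    next  : Candidate c (suc c mod n)
    next₂ : Candidate c (suc (suc c) mod n)
    prev  : Candidate c ((n ∸ 1 + c) mod n)
    prev₂ : Candidate c ((n ∸ 2 + c) mod n)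

  SqAdj⇒Candidate : ∀ c {y} → SqAdj (c mod n) y → Candidate c y
  SqAdj⇒Candidate c {y} (x≢y , short) with SqAdj-offset (toℕ<n (c mod n)) (toℕ<n y) (x≢y ∘ toℕ-injective) short
  ... | k , offset , j≡k+i = subst (Candidate c) (sym y≡k+c) (candidate offset)
    where
    y≡k+c : y ≡ (k + c) mod n
    y≡k+c = trans (sym (toℕ-mod-id y))
                  (mod-cong (trans j≡k+i (%-congʳ-+ k (trans (cong (_% n) (toℕ-mod c)) (m%n%n≡m%n c n)))))
    candidate : Offset n k → Candidate c ((k + c) mod n)
    candidate (inj₁ refl)                = next
    candidate (inj₂ (inj₁ refl))         = next₂
    candidate (inj₂ (inj₂ (inj₁ refl))) = prev
    candidate (inj₂ (inj₂ (inj₂ refl))) = prev₂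

Gap : (ℕ → ℕ → Set) → ℕ → Set
Gap F p = ¬ F p (suc p)

-- Each rule holds because the vertex p, p + 1 or p + 2 misses at most one of its four
-- neighbours in the square of the cycle.
record GapRules (F : ℕ → ℕ → Set) : Set where
  field
    symmetric       : ∀ {a b} → F a b → F b a
    step?           : ∀ p → Dec (F p (suc p))
    skip-gap        : ∀ {p} → Gap F p → F p (2 + p)
    step-after-gap  : ∀ {p} → Gap F p → F (1 + p) (2 + p)
    skip-after-gap  : ∀ {p} → Gap F p → F (1 + p) (3 + p)
    skip-before-gap : ∀ {p} → Gap F (1 + p) → F p (2 + p)

-- Adding r on the right lets every rule transfer definitionally, as suc p + r reduces to suc (p + r).
Rotate : ℕ → (ℕ → ℕ → Set) → ℕ → ℕ → Set
Rotate r F a b = F (a + r) (b + r)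

rotate : ∀ {F} r → GapRules F → GapRules (Rotate r F)
rotate r rules = record
  { symmetric      = symmetric       ; step?           = λ p → step? (p + r)
  ; skip-gap       = skip-gap        ; step-after-gap  = step-after-gap
  ; skip-after-gap = skip-after-gap  ; skip-before-gap = skip-before-gap
  }
  where open GapRules rules

record Periodic (N : ℕ) .{{_ : NonZero N}} (F : ℕ → ℕ → Set) : Set where
  field
    resp-mod : ∀ {a a′ b b′} → a % N ≡ a′ % N → b % N ≡ b′ % N → F a b → F a′ b′

module PeriodicProperties {N : ℕ} .{{_ : NonZero N}} {F : ℕ → ℕ → Set} (periodic : Periodic N F) where
  open Residues {n = N}
  open Periodic periodic

  rotate-periodic : ∀ r → Periodic N (Rotate r F)
  rotate-periodic r = record { resp-mod = λ a≡ b≡ → resp-mod (%-congˡ-+ r a≡) (%-congˡ-+ r b≡) }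

  Gap-periodic : ∀ {a b} → a % N ≡ b % N → Gap F a → Gap F b
  Gap-periodic a≡b gap = gap ∘ resp-mod (sym a≡b) (%-congʳ-+ 1 (sym a≡b))

record HamiltonianCycle (N : ℕ) (F : ℕ → ℕ → Set) : Set where
  field
    order           : ℕ → ℕ
    order-<         : ∀ {k} → k < N → order k < N
    order-injective : ∀ {a b} → a < N → b < N → order a ≡ order b → a ≡ b
    order-step      : ∀ {k} → suc k < N → F (order k) (order (suc k))
    order-closes    : F (order (N ∸ 1)) (order 0)

-- The greedy tour

module AdjacentTranspositions (s : ℕ → Bool) (separated : ∀ {k} → s k ≡ true → s (suc k) ≡ false) where

  s⁻ : ℕ → Bool
  s⁻ zero    = false
  s⁻ (suc k) = s k

  π : ℕ → ℕ
  π k = if s k then suc k else if s⁻ k then pred k else k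

  π-left : ∀ k → s k ≡ true → π k ≡ suc k
  π-left k sk rewrite sk = refl

  π-right : ∀ k → s k ≡ true → π (suc k) ≡ k
  π-right k sk rewrite separated sk | sk = refl

  π-fixed : ∀ k → s k ≡ false → s⁻ k ≡ false → π k ≡ k
  π-fixed k sk s⁻k rewrite sk | s⁻k = refl

  π-involutive : ∀ k → π (π k) ≡ k
  π-involutive k with s k in sk | s⁻ k in s⁻k
  ... | true  | _     = π-right k sk
  ... | false | false = π-fixed k sk s⁻k
  π-involutive (suc k) | false | true = π-left k s⁻k

  π-injective : ∀ {a b} → π a ≡ π b → a ≡ b
  π-injective {a} {b} eq = trans (sym (π-involutive a)) (trans (cong π eq) (π-involutive b))

  π-≤ : ∀ k → π k ≤ suc k
  π-≤ k with s k | s⁻ k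
  ... | true  | _     = ≤-refl
  ... | false | true  = ≤-trans pred[n]≤n (n≤1+n k)
  ... | false | false = n≤1+n k

  π-≤-unswapped : ∀ {k j} → s k ≡ false → j ≤ k → π j ≤ k
  π-≤-unswapped {k} sk j≤k with m≤n⇒m<n∨m≡n j≤k
  ... | inj₁ j<k  = ≤-trans (π-≤ _) j<k
  ... | inj₂ refl rewrite sk with s⁻ k
  ...   | true  = pred[n]≤n
  ...   | false = ≤-refl

module Greedy {F : ℕ → ℕ → Set} (rules : GapRules F) where
  open GapRules rules

  gap : ℕ → Bool
  gap p = not (does (step? p))

  gap-true : ∀ {p} → gap p ≡ true → Gap F p
  gap-true {p} _  with step? p
  gap-true     () | yes _
  gap-true     _  | no ¬step = ¬step

  Gap⇒gap : ∀ {p} → Gap F p → gap p ≡ true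
  Gap⇒gap {p} ¬step with step? p
  ... | yes step = contradiction step ¬step
  ... | no _     = refl

  -- detour (suc p) ≡ true: the tour runs p, p + 2, p + 1, p + 3, bypassing the gaps at p and p + 2
  detour : ℕ → Bool
  detour zero          = false
  detour (suc zero)    = gap 0
  detour (suc (suc p)) = gap (suc p) ∧ not (detour p)

  detour⇒Gap : ∀ {p} → detour (suc p) ≡ true → Gap F p
  detour⇒Gap {zero}  d = gap-true d
  detour⇒Gap {suc p} d with gap (suc p) in g
  ... | true = gap-true g

  step⇒¬detour : ∀ {p} → F p (suc p) → detour (suc p) ≡ false
  step⇒¬detour {p} step with detour (suc p) in d
  ... | false = refl
  ... | true  = contradiction step (detour⇒Gap d)

  detour-separated : ∀ {k} → detour k ≡ true → detour (suc k) ≡ false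
  detour-separated {suc p} d = step⇒¬detour (step-after-gap (detour⇒Gap d))

  detour-spaced : ∀ {k} → detour k ≡ true → detour (2 + k) ≡ false
  detour-spaced d rewrite d = ∧-zeroʳ _

  open AdjacentTranspositions detour (λ {k} → detour-separated {k})

  Gap⇒bypassed : ∀ {p} → Gap F p → detour (suc p) ≡ false → s⁻ p ≡ true
  Gap⇒bypassed {zero}  g d = contradiction (trans (sym (Gap⇒gap g)) d) λ ()
  Gap⇒bypassed {suc p} g d rewrite Gap⇒gap g with detour p
  Gap⇒bypassed {suc p} g () | false
  ... | true = refl

  step-in-detour : ∀ k → detour k ≡ true → F (π k) (π (suc k))
  step-in-detour (suc p) dk =
    subst₂ F (sym (π-left (suc p) dk)) (sym (π-right (suc p) dk)) (symmetric (step-after-gap (detour⇒Gap dk)))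

  step-into-detour : ∀ k → detour k ≡ false → detour (suc k) ≡ true → F (π k) (π (suc k))
  step-into-detour k dk dk′ =
    subst₂ F (sym (π-fixed k dk (s⁻≡false k dk′))) (sym (π-left (suc k) dk′)) (skip-gap (detour⇒Gap dk′))
    where
    s⁻≡false : ∀ k → detour (suc k) ≡ true → s⁻ k ≡ false
    s⁻≡false zero    _   = refl
    s⁻≡false (suc j) dk′ = ¬-not λ dj → contradiction (trans (sym dk′) (detour-spaced dj)) λ ()

  step-after-detour : ∀ k → detour k ≡ false → detour (suc k) ≡ false → s⁻ k ≡ true → F (π k) (π (suc k))
  step-after-detour (suc zero)    _  _   ()
  step-after-detour (suc (suc p)) dk dk′ s⁻k =
    subst₂ F (sym (π-right (suc p) s⁻k)) (sym (π-fixed (3 + p) dk′ dk)) (skip-after-gap (detour⇒Gap s⁻k))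

  step-outside-detour : ∀ k → detour k ≡ false → detour (suc k) ≡ false → s⁻ k ≡ false → F (π k) (π (suc k))
  step-outside-detour k dk dk′ s⁻k = subst₂ F (sym (π-fixed k dk s⁻k)) (sym (π-fixed (suc k) dk′ dk)) step
    where
    step : F k (suc k)
    step with step? k
    ... | yes step = step
    ... | no gap   = contradiction (trans (sym s⁻k) (Gap⇒bypassed gap dk′)) λ ()

  π-step : ∀ k → F (π k) (π (suc k))
  π-step k = by-cases (detour k) refl (detour (suc k)) refl (s⁻ k) refl
    where
    by-cases : ∀ b → detour k ≡ b → ∀ b′ → detour (suc k) ≡ b′ → ∀ b″ → s⁻ k ≡ b″ → F (π k) (π (suc k))
    by-cases true  dk _     _   _     _   = step-in-detour k dk
    by-cases false dk true  dk′ _     _   = step-into-detour k dk dk′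
    by-cases false dk false dk′ true  s⁻k = step-after-detour k dk dk′ s⁻k
    by-cases false dk false dk′ false s⁻k = step-outside-detour k dk dk′ s⁻k

  greedy-cycle : ∀ {M} → Periodic (2 + M) F → F M (1 + M) → F (1 + M) (2 + M) → HamiltonianCycle (2 + M) F
  greedy-cycle {M} periodic step₀ step₁ = record
    { order           = π
    ; order-<         = λ k<N → s≤s (π-≤-unswapped no-detour₀ (s≤s⁻¹ k<N))
    ; order-injective = λ _ _ → π-injective
    ; order-step      = λ {k} _ → π-step k
    ; order-closes    = Periodic.resp-mod periodic refl (n%n≡0 (2 + M))
                          (subst (F (π (1 + M))) π-fixes-N (π-step (1 + M)))
    }
    where
    no-detour₀ = step⇒¬detour step₀
    π-fixes-N : π (2 + M) ≡ 2 + M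
    π-fixes-N = π-fixed (2 + M) (step⇒¬detour step₁) no-detour₀

-- The zigzag tour

parity : ∀ n → (∃[ h ] n ≡ 2 * h) ⊎ (∃[ h ] n ≡ suc (2 * h))
parity zero = inj₁ (0 , refl)
parity (suc n) with parity n
... | inj₁ (h , n≡2h)   = inj₂ (h , cong suc n≡2h)
... | inj₂ (h , n≡2h+1) = inj₁ (suc h , trans (cong suc n≡2h+1) (sym (*-suc 2 h)))

zigzag : ℕ → ℕ → ℕ
zigzag M k with k <? M
... | yes _ = suc (2 * k)
... | no  _ = 2 * (2 * M ∸ suc k)

zigzag-low : ∀ {M k} → k < M → zigzag M k ≡ suc (2 * k)
zigzag-low {M} {k} k<M with k <? M
... | yes _   = refl
... | no  k≮M = contradiction k<M k≮M

zigzag-high : ∀ {M k} → M ≤ k → zigzag M k ≡ 2 * (2 * M ∸ suc k)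
zigzag-high {M} {k} M≤k with k <? M
... | yes k<M = contradiction M≤k (<⇒≱ k<M)
... | no  _   = refl

module Alternating {F : ℕ → ℕ → Set} (rules : GapRules F) (step₀ : F 0 1)
                   (alternating : ∀ p → Gap F p ⊎ Gap F (suc p)) where
  open GapRules rules

  step⇒Gap-after : ∀ {p} → F p (suc p) → Gap F (suc p)
  step⇒Gap-after {p} step = [ contradiction step , (λ gap → gap) ]′ (alternating p)

  steps-at-even : ∀ i → F (2 * i) (suc (2 * i)) × Gap F (suc (2 * i))
  steps-at-even zero    = step₀ , step⇒Gap-after step₀
  steps-at-even (suc i) rewrite *-suc 2 i =
    let step = step-after-gap (proj₂ (steps-at-even i)) in step , step⇒Gap-after step

  module Zigzag (h : ℕ) where
    M N : ℕ
    M = suc h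
    N = 2 * M

    N∸M≡M : N ∸ M ≡ M
    N∸M≡M = trans (m+n∸m≡n M (M + 0)) (+-identityʳ M)

    N∸[2+h]≡h : N ∸ suc (suc h) ≡ h
    N∸[2+h]≡h = trans (cong (_∸ suc (suc h)) (2*[1+h]≡[2+h]+h h)) (m+n∸m≡n (suc (suc h)) h)
      where
      2*[1+h]≡[2+h]+h : ∀ h → 2 * suc h ≡ suc (suc h) + h
      2*[1+h]≡[2+h]+h = solve-∀

    zigzag-< : ∀ {k} → k < N → zigzag M k < N
    zigzag-< {k} k<N with k <? M
    ... | yes k<M = subst (_≤ N) (*-suc 2 k) (*-monoʳ-≤ 2 k<M)
    ... | no  k≮M = *-monoʳ-< 2 (subst (N ∸ suc k <_) N∸M≡M (∸-monoʳ-< (s≤s (≮⇒≥ k≮M)) k<N))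

    zigzag-injective : ∀ {a b} → a < N → b < N → zigzag M a ≡ zigzag M b → a ≡ b
    zigzag-injective {a} {b} a<N b<N eq with a <? M | b <? M
    ... | yes _ | yes _ = *-cancelˡ-≡ a b 2 (suc-injective eq)
    ... | yes _ | no  _ = contradiction (sym eq) (even≢odd (N ∸ suc b) a)
    ... | no  _ | yes _ = contradiction eq (even≢odd (N ∸ suc a) b)
    ... | no  _ | no  _ = suc-injective (∸-cancelˡ-≡ a<N b<N (*-cancelˡ-≡ _ _ 2 eq))

    zigzag-step : ∀ {k} → suc k < N → F (zigzag M k) (zigzag M (suc k))
    zigzag-step {k} sk<N with k <? M | suc k <? M
    ... | yes k<M | yes _ =
      subst (λ e → F (suc (2 * k)) (suc e)) (sym (*-suc 2 k)) (skip-gap (proj₂ (steps-at-even k)))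
    ... | yes k<M | no sk≮M rewrite ≤-antisym (s≤s⁻¹ k<M) (s≤s⁻¹ (≮⇒≥ sk≮M)) | N∸[2+h]≡h =
      symmetric (proj₁ (steps-at-even h))
    ... | no k≮M  | yes sk<M = contradiction (<-trans (n<1+n k) sk<M) k≮M
    ... | no _    | no _ =
      subst (λ e → F (2 * e) (2 * c)) (sym (+-∸-assoc 1 sk<N))
        (subst (λ e → F e (2 * c)) (sym (*-suc 2 c)) (symmetric (skip-before-gap (proj₂ (steps-at-even c)))))
      where c = N ∸ suc (suc k)

    zigzag-closes : F (zigzag M (N ∸ 1)) (zigzag M 0)
    zigzag-closes =
      subst₂ F (sym (trans (zigzag-high M≤N∸1) (cong (2 *_) (n∸n≡0 N)))) (sym (zigzag-low {M} {0} z<s)) step₀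
      where
      M≤N∸1 : M ≤ N ∸ 1
      M≤N∸1 = ≤-trans (s≤s (m≤m+n h 0)) (m≤n+m _ h)

    zigzag-cycle : HamiltonianCycle N F
    zigzag-cycle = record
      { order = zigzag M ; order-< = zigzag-< ; order-injective = zigzag-injective
      ; order-step = zigzag-step ; order-closes = zigzag-closes
      }

  alternating-cycle : ∀ {m} → Periodic (2 + m) F → HamiltonianCycle (2 + m) F
  alternating-cycle {m} periodic with parity (2 + m)
  ... | inj₁ (suc h , N≡2h) = subst (λ N → HamiltonianCycle N F) (sym N≡2h) (Zigzag.zigzag-cycle h)
  ... | inj₂ (h , N≡2h+1) =
    contradiction (Periodic.resp-mod periodic (sym (n%n≡0 (2 + m))) (sym ([m+n]%n≡m%n 1 (2 + m))) step₀)
                  (subst (Gap F) (sym N≡2h+1) (proj₂ (steps-at-even h)))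

module _ {m : ℕ} {F : ℕ → ℕ → Set} (rules : GapRules F) (periodic : Periodic (2 + m) F) where
  open GapRules rules
  open PeriodicProperties periodic
  open Periodic periodic
  open Residues {n = 2 + m}

  private
    N = 2 + m

  two-steps-or-alternation : (∃[ i ] F i (suc i) × F (suc i) (2 + i)) ⊎ (∀ p → Gap F p ⊎ Gap F (suc p))
  two-steps-or-alternation with anyUpTo? (λ i → step? i ×-dec step? (suc i)) N
  ... | yes (i , _ , steps) = inj₁ (i , steps)
  ... | no ¬two-steps = inj₂ λ p →
    Sum.map (Gap-periodic (m%n%n≡m%n p N)) (Gap-periodic (%-congʳ-+ 1 {p % N} {p} (m%n%n≡m%n p N)))
            (alternation-below (m%n<n p N))
    where
    alternation-below : ∀ {q} → q < N → Gap F q ⊎ Gap F (suc q)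
    alternation-below {q} q<N with step? q | step? (suc q)
    ... | no gap   | _         = inj₁ gap
    ... | yes _    | no gap    = inj₂ gap
    ... | yes step | yes step′ = contradiction (q , q<N , step , step′) ¬two-steps

  -- Rotating by 2 + i turns the two steps at i and i + 1 into the last two edges of the greedy tour.
  hamiltonian-cycle : ∃[ r ] HamiltonianCycle N (Rotate r F)
  hamiltonian-cycle with two-steps-or-alternation
  ... | inj₁ (i , step₀ , step₁) =
    2 + i , Greedy.greedy-cycle (rotate (2 + i) rules) (rotate-periodic (2 + i))
                                (resp-mod (shift 0) (shift 1) step₀) (resp-mod (shift 1) (shift 2) step₁)
    where
    shift : ∀ k → (k + i) % N ≡ (k + (m + (2 + i))) % N
    shift k = %-congʳ-+ k {i} {m + (2 + i)}
                (sym (trans (cong (_% N) (trans (+-suc m (suc i)) (cong suc (+-suc m i)))) ([n+m]%n≡m%n i)))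
  ... | inj₂ alternation with step? 0
  ...   | yes step₀ = 0 , Alternating.alternating-cycle (rotate 0 rules) step₀ (λ p → alternation (p + 0))
                            (rotate-periodic 0)
  ...   | no gap₀   = 1 , Alternating.alternating-cycle (rotate 1 rules) (step-after-gap gap₀) (λ p → alternation (p + 1))
                            (rotate-periodic 1)

-- Subgraphs of the square of the cycle

module _ {m : ℕ} (H : Graph (2 + m)) where
  open Residues {n = 2 + m}

  private
    n = 2 + m

  AdjMod : ℕ → ℕ → Set
  AdjMod a b = Adj H (a mod n) (b mod n)

  AdjMod-periodic : Periodic n AdjMod
  AdjMod-periodic = record
    { resp-mod = λ {a} {a′} {b} {b′} a≡a′ b≡b′ → subst₂ (Adj H) (mod-cong {a} {a′} a≡a′) (mod-cong {b} {b′} b≡b′) }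

  prev-mod : ∀ {k} p → k ≤ n → (n ∸ k + (k + p)) mod n ≡ p mod n
  prev-mod {k} p k≤n = mod-cong {n ∸ k + (k + p)} {p} ([n∸k+[k+m]]%n≡m%n p k≤n)

  module _ (sub : SubgraphOfCycleSquare H) (δ≥3 : MinDegreeAtLeast 3 H) where

    ¬neighbours⊆pair : ∀ c {p q} → (∀ {y} → Candidate c y → Adj H (c mod n) y → y ≡ p ⊎ y ≡ q) → ⊥
    ¬neighbours⊆pair c ⊆pair =
      contradiction (≤-trans (δ≥3 (c mod n)) (degree≤2 H λ y adj → ⊆pair (SqAdj⇒Candidate c (sub _ y adj)) adj))
                    λ { (s≤s (s≤s ())) }

    gap-rules : GapRules AdjMod
    gap-rules = record
      { symmetric = Graph.sym H
      ; step? = λ p → adj? H _ _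
      ; skip-gap = λ {p} gap → decidable-stable (adj? H _ _) λ ¬skip → ¬neighbours⊆pair p λ where
          next  adj → contradiction adj gap
          next₂ adj → contradiction adj ¬skip
          prev  _   → inj₁ refl
          prev₂ _   → inj₂ refl
      ; step-after-gap = λ {p} gap → decidable-stable (adj? H _ _) λ ¬step → ¬neighbours⊆pair (1 + p) λ where
          next  adj → contradiction adj ¬step
          next₂ _   → inj₁ refl
          prev  adj → contradiction (Graph.sym H (subst (Adj H _) (prev-mod p z<s) adj)) gap
          prev₂ _   → inj₂ refl
      ; skip-after-gap = λ {p} gap → decidable-stable (adj? H _ _) λ ¬skip → ¬neighbours⊆pair (1 + p) λ where
          next  _   → inj₁ refl
          next₂ adj → contradiction adj ¬skip
          prev  adj → contradiction (Graph.sym H (subst (Adj H _) (prev-mod p z<s) adj)) gap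
          prev₂ _   → inj₂ refl
      ; skip-before-gap = λ {p} gap → decidable-stable (adj? H _ _) λ ¬skip → ¬neighbours⊆pair (2 + p) λ where
          next  _   → inj₁ refl
          next₂ _   → inj₂ refl
          prev  adj → contradiction (Graph.sym H (subst (Adj H _) (prev-mod (1 + p) z<s) adj)) gap
          prev₂ adj → contradiction (Graph.sym H (subst (Adj H _) (prev-mod p (s≤s z<s)) adj)) ¬skip
      }

  HamiltonianCycle⇒Hamiltonian : ∀ r → HamiltonianCycle n (Rotate r AdjMod) → Hamiltonian H
  HamiltonianCycle⇒Hamiltonian r cycle = v , v-injective , v-step
    where
    open HamiltonianCycle cycle
    v : Fin n → Fin n
    v i = (order (toℕ i) + r) mod n

    v-injective : ∀ {i j} → v i ≡ v j → i ≡ j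
    v-injective {i} {j} vi≡vj = toℕ-injective (order-injective (toℕ<n i) (toℕ<n j) (begin
      order (toℕ i)      ≡⟨ m<n⇒m%n≡m (order-< (toℕ<n i)) ⟨
      order (toℕ i) % n  ≡⟨ %-cancelʳ-+ {order (toℕ i)} {order (toℕ j)} r
                              (trans (sym (toℕ-mod (order (toℕ i) + r))) (trans (cong toℕ vi≡vj) (toℕ-mod (order (toℕ j) + r)))) ⟩
      order (toℕ j) % n  ≡⟨ m<n⇒m%n≡m (order-< (toℕ<n j)) ⟩
      order (toℕ j)      ∎))
      where open ≡-Reasoning

    v-step : ∀ k → Adj H (v k) (v (sucMod k))
    v-step k with toℕ-sucMod k
    ... | inj₁ (≡suc , suc<n) = subst (λ j → Adj H (v k) ((order j + r) mod n)) (sym ≡suc) (order-step suc<n)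
    ... | inj₂ (≡0 , ≡last)   =
      subst₂ (λ i j → Adj H ((order i + r) mod n) ((order j + r) mod n)) (sym ≡last) (sym ≡0) order-closes

proposition1p14 : (n : ℕ) → 4 ≤ n → (H : Graph n) → SubgraphOfCycleSquare H →
    MinDegreeAtLeast 3 H → Hamiltonian H
proposition1p14 (suc (suc m)) _ H sub δ≥3 =
  let r , cycle = hamiltonian-cycle (gap-rules H sub δ≥3) (AdjMod-periodic H)
  in  HamiltonianCycle⇒Hamiltonian H r cycle
proposition1p14 (suc zero) (s≤s ())
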